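{- The hypersequent $J=\ \Rightarrow p\,/\!/\,\Rightarrow\Box(\neg\Box\Box p\land\neg\Box\Box q)\,/\!/\,\Rightarrow q$ is not derivable in cut-free $\mathrm{RKB}$.
   Context: Hypersequents $S_1\,/\!/\,\dots\,/\!/\,S_n$ are finite lists of sequents $\Gamma\Rightarrow\Delta$ (pairs of finite sets of formulas). Cut-free $\mathrm{RKB}$ has: axiom $p\Rightarrow p$; external weakening at the ends ($G$ to $\Rightarrow\,/\!/\,G$, $G$ to $G\,/\!/\,\Rightarrow$); internal weakening in any component; the usual sequent rules for $\neg,\land,\lor$ in any component; $\Box\mathrm{R}$: from $G\,/\!/\,\Gamma\Rightarrow\Delta\,/\!/\,\Rightarrow\phi$ infer $G\,/\!/\,\Gamma\Rightarrow\Box\phi,\Delta$; $\Box\mathrm{L}$: from $G\,/\!/\,\Gamma\Rightarrow\Delta\,/\!/\,\Sigma,\phi\Rightarrow\Lambda\,/\!/\,H$ infer $G\,/\!/\,\Gamma,\Box\phi\Rightarrow\Delta\,/\!/\,\Sigma\Rightarrow\Lambda\,/\!/\,H$; and $Sym$: from $S_1\,/\!/\,\dots\,/\!/\,S_n$ infer $S_n\,/\!/\,\dots\,/\!/\,S_1$. -}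

module Defs where

open import Data.Nat using (ℕ)
open import Data.List using (List; []; _∷_; _++_; [_]; reverse)
open import Data.List.Membership.Propositional using (_∈_)
open import Data.List.Relation.Binary.Pointwise using (Pointwise)
open import Data.Product using (_×_)

infix 4 _⇒_
infixr 9 ¬'_ □_
infixr 8 _∧'_ _∨'_

data Fml : Set where
  atom : ℕ → Fml
  ¬'_  : Fml → Fml
  _∧'_ : Fml → Fml → Fml
  _∨'_ : Fml → Fml → Fml
  □_   : Fml → Fml

-- A sequent Γ ⇒ Δ; the finite SETS Γ, Δ are represented by lists,
-- identified up to having the same elements (see _≈ₕ_ and the rule `set`).
record Seq : Set where
  constructor _⇒_
  field
    ante : List Fml
    succ : List Fml

Hyp : Set
Hyp = List Seq

_≈ₛ_ : List Fml → List Fml → Set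
Γ ≈ₛ Δ = (∀ x → x ∈ Γ → x ∈ Δ) × (∀ x → x ∈ Δ → x ∈ Γ)

_≈q_ : Seq → Seq → Set
(Γ ⇒ Δ) ≈q (Γ' ⇒ Δ') = (Γ ≈ₛ Γ') × (Δ ≈ₛ Δ')

_≈ₕ_ : Hyp → Hyp → Set
_≈ₕ_ = Pointwise _≈q_

-- Cut-free RKB.  `φ ∷ Γ` denotes the set Γ ∪ {φ}.
data RKB : Hyp → Set where
  set  : ∀ {G G'} → G ≈ₕ G' → RKB G → RKB G'
  ax   : ∀ n → RKB [ (atom n ∷ []) ⇒ (atom n ∷ []) ]
  ewL  : ∀ {G} → RKB G → RKB (([] ⇒ []) ∷ G)
  ewR  : ∀ {G} → RKB G → RKB (G ++ [ [] ⇒ [] ])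
  iwL  : ∀ G H {Γ Δ} φ → RKB (G ++ (Γ ⇒ Δ) ∷ H) → RKB (G ++ (φ ∷ Γ ⇒ Δ) ∷ H)
  iwR  : ∀ G H {Γ Δ} φ → RKB (G ++ (Γ ⇒ Δ) ∷ H) → RKB (G ++ (Γ ⇒ φ ∷ Δ) ∷ H)
  ¬L   : ∀ G H {Γ Δ} φ → RKB (G ++ (Γ ⇒ φ ∷ Δ) ∷ H) → RKB (G ++ (¬' φ ∷ Γ ⇒ Δ) ∷ H)
  ¬R   : ∀ G H {Γ Δ} φ → RKB (G ++ (φ ∷ Γ ⇒ Δ) ∷ H) → RKB (G ++ (Γ ⇒ ¬' φ ∷ Δ) ∷ H)
  ∧L   : ∀ G H {Γ Δ} φ ψ → RKB (G ++ (φ ∷ ψ ∷ Γ ⇒ Δ) ∷ H)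
                        → RKB (G ++ ((φ ∧' ψ) ∷ Γ ⇒ Δ) ∷ H)
  ∧R   : ∀ G H {Γ Δ} φ ψ → RKB (G ++ (Γ ⇒ φ ∷ Δ) ∷ H) → RKB (G ++ (Γ ⇒ ψ ∷ Δ) ∷ H)
                        → RKB (G ++ (Γ ⇒ (φ ∧' ψ) ∷ Δ) ∷ H)
  ∨L   : ∀ G H {Γ Δ} φ ψ → RKB (G ++ (φ ∷ Γ ⇒ Δ) ∷ H) → RKB (G ++ (ψ ∷ Γ ⇒ Δ) ∷ H)
                        → RKB (G ++ ((φ ∨' ψ) ∷ Γ ⇒ Δ) ∷ H)
  ∨R   : ∀ G H {Γ Δ} φ ψ → RKB (G ++ (Γ ⇒ φ ∷ ψ ∷ Δ) ∷ H)
                        → RKB (G ++ (Γ ⇒ (φ ∨' ψ) ∷ Δ) ∷ H)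
  □R   : ∀ G {Γ Δ} φ → RKB (G ++ (Γ ⇒ Δ) ∷ ([] ⇒ φ ∷ []) ∷ [])
                    → RKB (G ++ (Γ ⇒ (□ φ) ∷ Δ) ∷ [])
  □L   : ∀ G H {Γ Δ Σ Λ} φ → RKB (G ++ (Γ ⇒ Δ) ∷ (φ ∷ Σ ⇒ Λ) ∷ H)
                          → RKB (G ++ ((□ φ) ∷ Γ ⇒ Δ) ∷ (Σ ⇒ Λ) ∷ H)
  sym  : ∀ {G} → RKB G → RKB (reverse G)

p q : Fml
p = atom 0
q = atom 1

J : Hyp
J = ([] ⇒ p ∷ [])
  ∷ ([] ⇒ □ ((¬' (□ (□ p))) ∧' (¬' (□ (□ q)))) ∷ [])
  ∷ ([] ⇒ q ∷ [])
  ∷ []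

-- Reading □ as the identity turns every rule of RKB into one that preserves classical
-- validity ("under each valuation some component is true"), so derivable hypersequents are
-- valid in this collapsed sense.
--
-- Call a hypersequent shaped when it is ⇒ x // ⇒ y // ⇒ z surrounded by empty components (up
-- to set equality), with x, z atoms and y an atom or a box. Reading a derivation of a shaped
-- hypersequent upwards, no logical rule applies: all antecedents are empty, no succedent
-- formula has a propositional main connective, and □R would need a box in the last component.
-- Set equality, Sym and external weakening keep the shape (Sym swapping x and z). Internal
-- weakening on the right either keeps it or empties one of ⇒ x, ⇒ y, ⇒ z; then a valuation
-- falsifying the other two formulas refutes the premise, contradicting soundness. For J the
-- middle formula collapses to ¬p ∧ ¬q, so such valuations exist.

module Submission where

open import Defs
open import Relation.Nullary using (¬_)
open import Data.Nat using (ℕ)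
open import Data.Bool using (Bool; true; false; not; _∧_; _∨_)
open import Data.Bool.Properties using (∧-zeroʳ; ∨-zeroʳ; not-¬)
open import Data.Empty using (⊥-elim)
open import Data.Product using (∃; _×_; _,_; proj₁; proj₂; swap; map₂)
open import Data.Sum using (_⊎_; inj₁; inj₂; [_,_]′) renaming (map to ⊎-map; map₁ to ⊎-map₁; map₂ to ⊎-map₂)
open import Function using (_∘_)
open import Data.List using (List; []; _∷_; _++_; [_]; reverse; _∷ʳ_)
open import Data.List.Properties using (reverse-++; reverse-involutive; unfold-reverse)
open import Data.List.Membership.Propositional using (_∈_)
open import Data.List.Relation.Binary.Subset.Propositional using (_⊆_)
open import Data.List.Relation.Binary.Subset.Propositional.Properties using (Any-resp-⊆)
open import Data.List.Relation.Binary.Pointwise using ([]; _∷_)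
open import Data.List.Relation.Unary.Any using (Any; here; there)
open import Data.List.Relation.Unary.All as All using (All; []; _∷_)
import Data.List.Relation.Unary.Any.Properties as Anyₚ
import Data.List.Relation.Unary.All.Properties as Allₚ
open import Relation.Binary.PropositionalEquality using (_≡_; refl; trans; cong; cong₂; subst)

open Seq

private variable
  P Q R : Seq → Set
  x y z : Fml

eval : (ℕ → Bool) → Fml → Bool
eval V (atom n) = V n
eval V (¬' φ)   = not (eval V φ)
eval V (φ ∧' ψ) = eval V φ ∧ eval V ψ
eval V (φ ∨' ψ) = eval V φ ∨ eval V ψ
eval V (□ φ)    = eval V φ

Holds : (ℕ → Bool) → Seq → Set
Holds V S = Any (λ φ → eval V φ ≡ false) (ante S) ⊎ Any (λ φ → eval V φ ≡ true) (succ S)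

Valid : Hyp → Set
Valid G = ∀ V → Any (Holds V) G

≈ₛ⇒⊆ : ∀ {Γ Δ} → Γ ≈ₛ Δ → Γ ⊆ Δ
≈ₛ⇒⊆ (Γ⊆Δ , _) = Γ⊆Δ _

any-window : ∀ G X {Y H} → (Any P X → Any P Y) → Any P (G ++ X ++ H) → Any P (G ++ Y ++ H)
any-window [] X f a = [ Anyₚ.++⁺ˡ ∘ f , Anyₚ.++⁺ʳ _ ]′ (Anyₚ.++⁻ X a)
any-window (S ∷ G) X f (here p)  = here p
any-window (S ∷ G) X f (there a) = there (any-window G X f a)

any-window₁ : ∀ G {A B H} → (P A → P B) → Any P (G ++ A ∷ H) → Any P (G ++ B ∷ H)
any-window₁ G f = any-window G [ _ ] (Anyₚ.singleton⁺ ∘ f ∘ Anyₚ.singleton⁻)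

any-window₂ : ∀ G {A B C H} → (P A → P B → P C) →
              Any P (G ++ A ∷ H) → Any P (G ++ B ∷ H) → Any P (G ++ C ∷ H)
any-window₂ []      f (here p)  (here p′) = here (f p p′)
any-window₂ []      f (here _)  (there b) = there b
any-window₂ []      f (there a) _         = there a
any-window₂ (S ∷ G) f (here p)  _         = here p
any-window₂ (S ∷ G) f (there _) (here p)  = here p
any-window₂ (S ∷ G) f (there a) (there b) = there (any-window₂ G f a b)

module _ (V : ℕ → Bool) where

  holds-resp-≈ : ∀ {S S′} → S ≈q S′ → Holds V S → Holds V S′
  holds-resp-≈ {_ ⇒ _} {_ ⇒ _} (Γ≈ , Δ≈) =
    ⊎-map (Any-resp-⊆ (≈ₛ⇒⊆ Γ≈)) (Any-resp-⊆ (≈ₛ⇒⊆ Δ≈))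

  holds-ax : ∀ n → Holds V (atom n ∷ [] ⇒ atom n ∷ [])
  holds-ax n with V n in Vn
  ... | false = inj₁ (here Vn)
  ... | true  = inj₂ (here Vn)

  holds-iwL : ∀ {Γ Δ φ} → Holds V (Γ ⇒ Δ) → Holds V (φ ∷ Γ ⇒ Δ)
  holds-iwL = ⊎-map₁ there

  holds-iwR : ∀ {Γ Δ φ} → Holds V (Γ ⇒ Δ) → Holds V (Γ ⇒ φ ∷ Δ)
  holds-iwR = ⊎-map₂ there

  holds-¬L : ∀ {Γ Δ φ} → Holds V (Γ ⇒ φ ∷ Δ) → Holds V (¬' φ ∷ Γ ⇒ Δ)
  holds-¬L (inj₁ r)         = inj₁ (there r)
  holds-¬L (inj₂ (here t))  = inj₁ (here (cong not t))
  holds-¬L (inj₂ (there v)) = inj₂ v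

  holds-¬R : ∀ {Γ Δ φ} → Holds V (φ ∷ Γ ⇒ Δ) → Holds V (Γ ⇒ ¬' φ ∷ Δ)
  holds-¬R (inj₁ (here f))  = inj₂ (here (cong not f))
  holds-¬R (inj₁ (there r)) = inj₁ r
  holds-¬R (inj₂ v)         = inj₂ (there v)

  holds-∧L : ∀ {Γ Δ φ ψ} → Holds V (φ ∷ ψ ∷ Γ ⇒ Δ) → Holds V (φ ∧' ψ ∷ Γ ⇒ Δ)
  holds-∧L {ψ = ψ} (inj₁ (here f)) = inj₁ (here (cong (_∧ eval V ψ) f))
  holds-∧L {φ = φ} (inj₁ (there (here f))) =
    inj₁ (here (trans (cong (eval V φ ∧_) f) (∧-zeroʳ (eval V φ))))
  holds-∧L (inj₁ (there (there r))) = inj₁ (there r)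
  holds-∧L (inj₂ v)                 = inj₂ v

  holds-∧R : ∀ {Γ Δ φ ψ} → Holds V (Γ ⇒ φ ∷ Δ) → Holds V (Γ ⇒ ψ ∷ Δ) → Holds V (Γ ⇒ φ ∧' ψ ∷ Δ)
  holds-∧R (inj₁ r)         _                 = inj₁ r
  holds-∧R (inj₂ (there v)) _                 = inj₂ (there v)
  holds-∧R (inj₂ (here _))  (inj₁ r)          = inj₁ r
  holds-∧R (inj₂ (here _))  (inj₂ (there v))  = inj₂ (there v)
  holds-∧R (inj₂ (here t))  (inj₂ (here t′))  = inj₂ (here (cong₂ _∧_ t t′))

  holds-∨L : ∀ {Γ Δ φ ψ} → Holds V (φ ∷ Γ ⇒ Δ) → Holds V (ψ ∷ Γ ⇒ Δ) → Holds V (φ ∨' ψ ∷ Γ ⇒ Δ)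
  holds-∨L (inj₂ v)         _                 = inj₂ v
  holds-∨L (inj₁ (there r)) _                 = inj₁ (there r)
  holds-∨L (inj₁ (here _))  (inj₂ v)          = inj₂ v
  holds-∨L (inj₁ (here _))  (inj₁ (there r))  = inj₁ (there r)
  holds-∨L (inj₁ (here f))  (inj₁ (here f′))  = inj₁ (here (cong₂ _∨_ f f′))

  holds-∨R : ∀ {Γ Δ φ ψ} → Holds V (Γ ⇒ φ ∷ ψ ∷ Δ) → Holds V (Γ ⇒ φ ∨' ψ ∷ Δ)
  holds-∨R (inj₁ r) = inj₁ r
  holds-∨R {ψ = ψ} (inj₂ (here t)) = inj₂ (here (cong (_∨ eval V ψ) t))
  holds-∨R {φ = φ} (inj₂ (there (here t))) =
    inj₂ (here (trans (cong (eval V φ ∨_) t) (∨-zeroʳ (eval V φ))))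
  holds-∨R (inj₂ (there (there v))) = inj₂ (there v)

  holds-□R : ∀ {Γ Δ φ} → Any (Holds V) ((Γ ⇒ Δ) ∷ ([] ⇒ φ ∷ []) ∷ []) → Any (Holds V) [ Γ ⇒ □ φ ∷ Δ ]
  holds-□R (here h)                        = here (holds-iwR h)
  holds-□R (there (here (inj₂ (here t))))  = here (inj₂ (here t))
  holds-□R (there (here (inj₂ (there ()))))

  holds-□L : ∀ {Γ Δ Σ Λ φ} → Any (Holds V) ((Γ ⇒ Δ) ∷ (φ ∷ Σ ⇒ Λ) ∷ []) →
             Any (Holds V) ((□ φ ∷ Γ ⇒ Δ) ∷ (Σ ⇒ Λ) ∷ [])
  holds-□L (here h)                         = here (holds-iwL h)
  holds-□L (there (here (inj₁ (here f))))   = here (inj₁ (here f))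
  holds-□L (there (here (inj₁ (there r))))  = there (here (inj₁ r))
  holds-□L (there (here (inj₂ v)))          = there (here (inj₂ v))

valid-resp-≈ : ∀ {G G′} → G ≈ₕ G′ → Valid G → Valid G′
valid-resp-≈ G≈ v V = go G≈ (v V)
  where
    go : ∀ {G G′} → G ≈ₕ G′ → Any (Holds V) G → Any (Holds V) G′
    go (S≈ ∷ _)  (here h)  = here (holds-resp-≈ V S≈ h)
    go (_ ∷ G≈) (there a) = there (go G≈ a)

sound : ∀ {G} → RKB G → Valid G
sound (set G≈ d)           = valid-resp-≈ G≈ (sound d)
sound (ax n)             V = here (holds-ax V n)
sound (ewL d)            V = there (sound d V)
sound (ewR d)            V = Anyₚ.++⁺ˡ (sound d V)
sound (iwL G H φ d)      V = any-window₁ G (holds-iwL V) (sound d V)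
sound (iwR G H φ d)      V = any-window₁ G (holds-iwR V) (sound d V)
sound (¬L G H φ d)       V = any-window₁ G (holds-¬L V) (sound d V)
sound (¬R G H φ d)       V = any-window₁ G (holds-¬R V) (sound d V)
sound (∧L G H φ ψ d)     V = any-window₁ G (holds-∧L V) (sound d V)
sound (∧R G H φ ψ d d′)  V = any-window₂ G (holds-∧R V) (sound d V) (sound d′ V)
sound (∨L G H φ ψ d d′)  V = any-window₂ G (holds-∨L V) (sound d V) (sound d′ V)
sound (∨R G H φ ψ d)     V = any-window₁ G (holds-∨R V) (sound d V)
sound (□R G φ d)         V = any-window G (_ ∷ _ ∷ []) (holds-□R V) (sound d V)
sound (□L G H φ d)       V = any-window G (_ ∷ _ ∷ []) (holds-□L V) (sound d V)
sound (sym d)            V = Anyₚ.reverse⁺ (sound d V)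

Within : List Fml → Seq → Set
Within ws S = ante S ⊆ [] × succ S ⊆ ws

Empty : Seq → Set
Empty S = S ≈q ([] ⇒ [])

Unit : Fml → Seq → Set
Unit w S = S ≈q ([] ⇒ [ w ])

AtMost : Fml → Seq → Set
AtMost w S = Unit w S ⊎ Empty S

≈ₛ-trans : ∀ {Γ Δ Θ} → Γ ≈ₛ Δ → Δ ≈ₛ Θ → Γ ≈ₛ Θ
≈ₛ-trans (f , g) (h , k) = (λ x → h x ∘ f x) , (λ x → g x ∘ k x)

≈q-trans : ∀ {S S′ S″} → S ≈q S′ → S′ ≈q S″ → S ≈q S″
≈q-trans {_ ⇒ _} {_ ⇒ _} {_ ⇒ _} (Γ≈ , Δ≈) (Γ≈′ , Δ≈′) = ≈ₛ-trans Γ≈ Γ≈′ , ≈ₛ-trans Δ≈ Δ≈′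

≈q-refl : ∀ {S} → S ≈q S
≈q-refl = ((λ _ m → m) , (λ _ m → m)) , ((λ _ m → m) , (λ _ m → m))

empty-within : ∀ {ws S} → Empty S → Within ws S
empty-within (Γ≈ , Δ≈) = ≈ₛ⇒⊆ Γ≈ , ⊥-elim ∘ Anyₚ.¬Any[] ∘ ≈ₛ⇒⊆ Δ≈

unit-within : ∀ {w ws S} → w ∈ ws → Unit w S → Within ws S
unit-within w∈ws (Γ≈ , Δ≈) = ≈ₛ⇒⊆ Γ≈ , λ m → [w]⊆ws (≈ₛ⇒⊆ Δ≈ m)
  where
    [w]⊆ws : [ _ ] ⊆ _
    [w]⊆ws (here refl) = w∈ws

atMost-within : ∀ {w S} → AtMost w S → Within [ w ] S
atMost-within = [ unit-within (here refl) , empty-within ]′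

nonempty-succ : ∀ {Γ φ Δ} → ¬ Empty (Γ ⇒ φ ∷ Δ)
nonempty-succ e = Anyₚ.¬Any[] (proj₂ (empty-within {[]} e) (here refl))

unit-shrink : ∀ {w Γ φ Δ} → Unit w (Γ ⇒ φ ∷ Δ) → AtMost w (Γ ⇒ Δ)
unit-shrink {Δ = []}    (Γ≈ , _)       = inj₂ (Γ≈ , ((λ _ ()) , (λ _ ())))
unit-shrink {Δ = d ∷ Δ} (Γ≈ , (to , _)) with to d (there (here refl))
-- d ∈ [ w ] forces d ≡ w, so w survives in the shrunken succedent.
... | here refl = inj₁ (Γ≈ , ((λ x → to x ∘ there) , λ { _ (here refl) → here refl }))

module _ {V : ℕ → Bool} where

  within-refuted : ∀ {ws S} → All (λ w → eval V w ≡ false) ws → Within ws S → ¬ Holds V S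
  within-refuted _  (ante⊆ , _) (inj₁ r) = Anyₚ.¬Any[] (Any-resp-⊆ ante⊆ r)
  within-refuted fs (_ , succ⊆) (inj₂ v) = Allₚ.All¬⇒¬Any (All.map not-¬ fs) (Any-resp-⊆ succ⊆ v)

  empty-refuted : ∀ {S} → Empty S → ¬ Holds V S
  empty-refuted = within-refuted [] ∘ empty-within

  atMost-refuted : ∀ {w S} → eval V w ≡ false → AtMost w S → ¬ Holds V S
  atMost-refuted w-false = within-refuted (w-false ∷ []) ∘ atMost-within

data Padded (P Q R : Seq → Set) : Hyp → Set where
  pad  : ∀ {S K} → Empty S → Padded P Q R K → Padded P Q R (S ∷ K)
  core : ∀ {S₁ S₂ S₃ K} → P S₁ → Q S₂ → R S₃ → All Empty K → Padded P Q R (S₁ ∷ S₂ ∷ S₃ ∷ K)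

Shaped : Fml → Fml → Fml → Hyp → Set
Shaped x y z = Padded (Unit x) (Unit y) (Unit z)

Padded-++ : ∀ {A B} → All Empty A → Padded P Q R B → Padded P Q R (A ++ B)
Padded-++ []       s = s
Padded-++ (e ∷ es) s = pad e (Padded-++ es s)

Padded-∷ʳ : ∀ {K S} → Padded P Q R K → Empty S → Padded P Q R (K ∷ʳ S)
Padded-∷ʳ (pad e s)      e′ = pad e (Padded-∷ʳ s e′)
Padded-∷ʳ (core a b c k) e′ = core a b c (Allₚ.∷ʳ⁺ k e′)

Padded-reverse : ∀ {K} → Padded P Q R K → Padded R Q P (reverse K)
Padded-reverse {K = S ∷ K} (pad e s) rewrite unfold-reverse S K = Padded-∷ʳ (Padded-reverse s) e
Padded-reverse {K = S₁ ∷ S₂ ∷ S₃ ∷ K} (core a b c k)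
  rewrite reverse-++ (S₁ ∷ S₂ ∷ S₃ ∷ []) K =
    Padded-++ (All.tabulate (All.lookup k ∘ Anyₚ.reverse⁻)) (core c b a [])

Padded-reverse⁻ : ∀ {K} → Padded P Q R (reverse K) → Padded R Q P K
Padded-reverse⁻ {K = K} s = subst (Padded _ _ _) (reverse-involutive K) (Padded-reverse s)

Padded-reverse-∷ʳ : ∀ {K S} → Padded P Q R (K ∷ʳ S) → Padded R Q P (S ∷ reverse K)
Padded-reverse-∷ʳ {K = K} {S} s = subst (Padded _ _ _) (reverse-++ K [ S ]) (Padded-reverse s)

Shaped-≈ : ∀ {K K′} → K ≈ₕ K′ → Shaped x y z K′ → Shaped x y z K
Shaped-≈ (S≈ ∷ K≈) (pad e s) = pad (≈q-trans S≈ e) (Shaped-≈ K≈ s)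
Shaped-≈ (S₁≈ ∷ S₂≈ ∷ S₃≈ ∷ K≈) (core a b c k) =
  core (≈q-trans S₁≈ a) (≈q-trans S₂≈ b) (≈q-trans S₃≈ c) (empties K≈ k)
  where
    empties : ∀ {K K′} → K ≈ₕ K′ → All Empty K′ → All Empty K
    empties []         []       = []
    empties (S≈ ∷ K≈) (e ∷ es) = ≈q-trans S≈ e ∷ empties K≈ es

Shaped-within : ∀ {K} → Shaped x y z K → All (Within (x ∷ y ∷ z ∷ [])) K
Shaped-within (pad e s)      = empty-within e ∷ Shaped-within s
Shaped-within (core a b c k) =
  unit-within (here refl) a ∷ unit-within (there (here refl)) b ∷
  unit-within (there (there (here refl))) c ∷ All.map empty-within k

Shaped-ante : ∀ G {H Γ Δ φ} → ¬ Shaped x y z (G ++ (φ ∷ Γ ⇒ Δ) ∷ H)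
Shaped-ante G s = Anyₚ.¬Any[] (proj₁ (All.head (Allₚ.++⁻ʳ G (Shaped-within s))) (here refl))

Shaped-succ : ∀ G {H Γ Δ φ} → Shaped x y z (G ++ (Γ ⇒ φ ∷ Δ) ∷ H) → φ ∈ x ∷ y ∷ z ∷ []
Shaped-succ G s = proj₂ (All.head (Allₚ.++⁻ʳ G (Shaped-within s))) (here refl)

Shaped-head : ∀ {S K} → Shaped x y z (S ∷ K) → Within [ x ] S
Shaped-head (pad e _)      = empty-within e
Shaped-head (core a _ _ _) = unit-within (here refl) a

Shaped-last : ∀ {K S} → Shaped x y z (K ∷ʳ S) → Within [ z ] S
Shaped-last = Shaped-head ∘ Padded-reverse-∷ʳ

Shaped-tail : ∀ {K} → Shaped x y z (([] ⇒ []) ∷ K) → Shaped x y z K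
Shaped-tail (pad _ s)                        = s
Shaped-tail (core (_ , (_ , [x]⊆[])) _ _ _) = ⊥-elim (Anyₚ.¬Any[] ([x]⊆[] _ (here refl)))

Shaped-init : ∀ {K} → Shaped x y z (K ∷ʳ ([] ⇒ [])) → Shaped x y z K
Shaped-init = Padded-reverse⁻ ∘ Shaped-tail ∘ Padded-reverse-∷ʳ

Shaped-iwR : ∀ G {H Γ Δ φ} → Shaped x y z (G ++ (Γ ⇒ φ ∷ Δ) ∷ H) →
             Padded (AtMost x) (AtMost y) (AtMost z) (G ++ (Γ ⇒ Δ) ∷ H)
Shaped-iwR []              (core a b c k) = core (unit-shrink a) (inj₁ b) (inj₁ c) k
Shaped-iwR (_ ∷ [])        (core a b c k) = core (inj₁ a) (unit-shrink b) (inj₁ c) k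
Shaped-iwR (_ ∷ _ ∷ [])    (core a b c k) = core (inj₁ a) (inj₁ b) (unit-shrink c) k
Shaped-iwR (_ ∷ _ ∷ _ ∷ G) (core _ _ _ k) = ⊥-elim (nonempty-succ (All.head (Allₚ.++⁻ʳ G k)))
Shaped-iwR []              (pad e _)      = ⊥-elim (nonempty-succ e)
Shaped-iwR (_ ∷ G)         (pad e s)      = pad e (Shaped-iwR G s)

record Countermodels (x y z : Fml) : Set where
  field
    without-x : ∃ λ V → eval V y ≡ false × eval V z ≡ false
    without-y : ∃ λ V → eval V x ≡ false × eval V z ≡ false
    without-z : ∃ λ V → eval V x ≡ false × eval V y ≡ false

Countermodels-sym : Countermodels x y z → Countermodels z y x
Countermodels-sym cm = record
  { without-x = map₂ swap (without-z)
  ; without-y = map₂ swap (without-y)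
  ; without-z = map₂ swap (without-x)
  }
  where open Countermodels cm

Refutable : Hyp → Set
Refutable K = ∃ λ V → All (λ S → ¬ Holds V S) K

refutable-invalid : ∀ {K} → Refutable K → ¬ Valid K
refutable-invalid (V , refuted) valid = Allₚ.All¬⇒¬Any refuted (valid V)

AtMost-split : ∀ {K} → Countermodels x y z →
               Padded (AtMost x) (AtMost y) (AtMost z) K → Shaped x y z K ⊎ Refutable K
AtMost-split cm (pad e s) = ⊎-map (pad e) (map₂ (empty-refuted e ∷_)) (AtMost-split cm s)
AtMost-split cm (core (inj₁ a) (inj₁ b) (inj₁ c) k) = inj₁ (core a b c k)
AtMost-split cm (core (inj₂ a) b c k) =
  let V , y-false , z-false = Countermodels.without-x cm in
  inj₂ (V , empty-refuted a ∷ atMost-refuted y-false b ∷ atMost-refuted z-false c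
          ∷ All.map empty-refuted k)
AtMost-split cm (core (inj₁ a) (inj₂ b) c k) =
  let V , x-false , z-false = Countermodels.without-y cm in
  inj₂ (V , atMost-refuted x-false (inj₁ a) ∷ empty-refuted b ∷ atMost-refuted z-false c
          ∷ All.map empty-refuted k)
AtMost-split cm (core (inj₁ a) (inj₁ b) (inj₂ c) k) =
  let V , x-false , y-false = Countermodels.without-z cm in
  inj₂ (V , atMost-refuted x-false (inj₁ a) ∷ atMost-refuted y-false (inj₁ b) ∷ empty-refuted c
          ∷ All.map empty-refuted k)

data ModalAtom : Fml → Set where
  atom : ∀ n → ModalAtom (atom n)
  box  : ∀ φ → ModalAtom (□ φ)

Shaped-underivable : ∀ {i j y K} → ModalAtom y → Countermodels (atom i) y (atom j) →
                     RKB K → ¬ Shaped (atom i) y (atom j) K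
Shaped-underivable {i} {j} {y} my cm = go
  where
    modal-succ : ∀ G {H Γ Δ φ} → Shaped (atom i) y (atom j) (G ++ (Γ ⇒ φ ∷ Δ) ∷ H) → ModalAtom φ
    modal-succ G s = All.lookup (atom i ∷ my ∷ atom j ∷ []) (Shaped-succ G s)

    go : ∀ {K} → RKB K → ¬ Shaped (atom i) y (atom j) K
    go (set K≈ d)        s = go d (Shaped-≈ K≈ s)
    go (ax n)            s = Shaped-ante [] s
    go (ewL d)           s = go d (Shaped-tail s)
    go (ewR d)           s = go d (Shaped-init s)
    go (iwL G H φ d)     s = Shaped-ante G s
    go (iwR G H φ d)     s with AtMost-split cm (Shaped-iwR G s)
    ... | inj₁ s′          = go d s′
    ... | inj₂ refutable   = refutable-invalid refutable (sound d)
    go (¬L G H φ d)      s = Shaped-ante G s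
    go (¬R G H φ d)      s with modal-succ G s
    ... | ()
    go (∧L G H φ ψ d)    s = Shaped-ante G s
    go (∧R G H φ ψ d _)  s with modal-succ G s
    ... | ()
    go (∨L G H φ ψ d _)  s = Shaped-ante G s
    go (∨R G H φ ψ d)    s with modal-succ G s
    ... | ()
    go (□R G φ d)        s with proj₂ (Shaped-last s) (here refl)
    ... | here ()
    go (□L G H φ d)      s = Shaped-ante G s
    go (sym d)           s = Shaped-underivable my (Countermodels-sym cm) d (Padded-reverse⁻ s)

mainTheorem15 : ¬ RKB J
mainTheorem15 d = Shaped-underivable (box _) countermodels d (core ≈q-refl ≈q-refl ≈q-refl [])
  where
    countermodels : Countermodels p (□ (¬' □ □ p ∧' ¬' □ □ q)) q
    countermodels = record
      { without-x = (λ { 0 → true ; _ → false }) , refl , refl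
      ; without-y = (λ _ → false) , refl , refl
      ; without-z = (λ { 0 → false ; _ → true }) , refl , refl
      }
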